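{- For every $m\ge1$, the pattern $1\,2^m$ is equivalent to the pattern $1\,2\,1^{m-1}$.
   Context: $a^d$ denotes the constant sequence $a\cdots a$ of length $d$. Partitions of $[n]$ are identified with canonical sequences $\pi_1\cdots\pi_n$ ($\pi_i=j$ iff $i$ lies in the $j$-th block, blocks ordered by increasing minima). A partition contains a pattern $\sigma$ if it has a subsequence order-isomorphic to $\sigma$, and avoids it otherwise; $p(n;\sigma)$ is the number of partitions of $[n]$ avoiding $\sigma$. Patterns $\sigma,\sigma'$ are equivalent if $p(n;\sigma)=p(n;\sigma')$ for all $n$. -}

module Defs where

open import Data.Nat using (ℕ; zero; suc; _+_; _≤_; _<_; _⊔_; _≤ᵇ_; _<ᵇ_; _≡ᵇ_)
open import Data.Bool using (Bool; true; false; _∧_; if_then_else_)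
open import Data.List using (List; []; _∷_; _++_; map; concatMap; length; filter; upTo; replicate; all; and)
open import Data.List.Relation.Unary.All using (All)
open import Relation.Binary.PropositionalEquality using (_≡_)
open import Relation.Nullary using (¬_)
open import Relation.Nullary.Decidable using (¬?)
open import Data.Bool.Properties using (_≟_)
open import Data.Bool.ListAction using (any)

-- Canonical sequences (restricted growth functions) of partitions of [n].
-- Values are 1-based: π₁ = 1 and π_{i+1} ≤ 1 + max(π₁..π_i).
-- extend m k : all canonical continuations of length k given current maximum m.
extend : ℕ → ℕ → List (List ℕ)
extend m zero = [] ∷ []
extend m (suc k) =
  concatMap (λ v → map (v ∷_) (extend (m ⊔ v) k)) (map suc (upTo (suc m)))

partitions : ℕ → List (List ℕ)
partitions n = extend 0 n

subseqs : List ℕ → List (List ℕ)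
subseqs [] = [] ∷ []
subseqs (x ∷ xs) = let r = subseqs xs in map (x ∷_) r ++ r

sameRel : ℕ → ℕ → List ℕ → List ℕ → Bool
sameRel a b [] [] = true
sameRel a b (x ∷ xs) (y ∷ ys) =
  ((a <ᵇ x) ≡ᵇB (b <ᵇ y)) ∧ ((x <ᵇ a) ≡ᵇB (y <ᵇ b)) ∧ sameRel a b xs ys
  where
  _≡ᵇB_ : Bool → Bool → Bool
  true ≡ᵇB true = true
  false ≡ᵇB false = true
  _ ≡ᵇB _ = false
sameRel a b _ _ = false

orderIso : List ℕ → List ℕ → Bool
orderIso [] [] = true
orderIso (x ∷ xs) (y ∷ ys) = sameRel x y xs ys ∧ orderIso xs ys
orderIso _ _ = false

containsᵇ : List ℕ → List ℕ → Bool
containsᵇ σ π = any (λ s → orderIso s σ) (subseqs π)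

Contains : List ℕ → List ℕ → Set
Contains σ π = containsᵇ σ π ≡ true

p : ℕ → List ℕ → ℕ
p n σ = length (filter (λ π → ¬? (containsᵇ σ π ≟ true)) (partitions n))

Equivalent : List ℕ → List ℕ → Set
Equivalent σ σ' = (n : ℕ) → p n σ ≡ p n σ'

module Submission where

-- For a canonical sequence π, the pattern 1 2^(c+1) occurs iff some letter y+2 occurs at least
-- c+1 times (the leading 1 plays the 1), and 1 2 1^c (c ≥ 1) occurs iff, for some x ≥ 1, at least
-- c copies of x follow the first x+1 (an x always precedes the first x+1).
-- Relabel π letter by letter according to the maximum M of the prefix read so far:
-- 1 ↦ M, v ↦ v-1 for 2 ≤ v ≤ M, and a new maximum M+1 stays M+1. The prefix maxima are unchanged,
-- so this only permutes the branches of the tree of canonical sequences and is a bijection on each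
-- length. The first y+2 of π stays the first y+2, and its later occurrences become exactly the
-- y+1 after it; so count (y+2) π - 1 copies of y+1 follow the first y+2, and the relabelling maps
-- the partitions avoiding 1 2^(c+1) onto those avoiding 1 2 1^c.

open import Defs
open import Level using (Level)
open import Data.Nat using (ℕ; zero; suc; pred; _∸_; _≤_; _<_; _<ᵇ_; _⊔_; z≤n; s≤s; s≤s⁻¹)
open import Data.Nat.Properties
  using ( ≤-refl; ≤-trans; ≤-antisym; <⇒≤; <⇒≱; ≮⇒≥; <-irrefl; ≤∧≢⇒<; n≤1+n; n<1+n
        ; m<1+n⇒m<n∨m≡n; m≥n⇒m⊔n≡m; ⊔-lub; ⊔-sel; m≤m⊔n; m≤n⊔m; suc[m]≤n⇒m≤pred[n]
        ; <ᵇ⇒<; <⇒<ᵇ; _<?_)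
  renaming (_≟_ to _≟ℕ_)
open import Data.Bool using (true; false)
open import Data.Bool.Properties using (T-≡; ∧-conicalˡ; ∧-conicalʳ; ⇔→≡; _≟_)
open import Data.List
  using (List; []; _∷_; _++_; [_]; map; concatMap; filter; length; replicate; upTo; applyUpTo)
open import Data.List.Properties
  using (map-∘; map-concatMap; concatMap-map; ++-assoc; map-upTo; map-applyUpTo; applyUpTo-∷ʳ)
open import Data.List.Membership.Propositional using (_∈_; find; lose)
open import Data.List.Membership.Propositional.Properties
  using (∈-++⁺ˡ; ∈-++⁺ʳ; ∈-++⁻; ∈-map⁺; ∈-map⁻)
open import Data.List.Relation.Unary.Any using (here)
open import Data.List.Relation.Unary.Any.Properties using (any⁺; any⁻)
open import Data.List.Relation.Unary.All as All using (All; []; _∷_)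
import Data.List.Relation.Unary.All.Properties as All
open import Data.List.Relation.Binary.Sublist.Propositional using (_⊆_; []; _∷_; _∷ʳ_)
open import Data.List.Relation.Binary.Sublist.Propositional.Properties
  using ([]⊆-universal; ∷ˡ⁻; All-resp-⊆)
open import Data.List.Relation.Binary.Permutation.Propositional as ↭
  using (_↭_; ↭-refl; ↭-trans; module PermutationReasoning)
open import Data.List.Relation.Binary.Permutation.Propositional.Properties
  using (++⁺; ++⁺ˡ; shift; shifts; ↭-length; filter-↭)
import Data.List.Relation.Binary.Permutation.Propositional.Properties as ↭
open import Data.Product using (∃; ∃₂; _×_; _,_; proj₁; proj₂; map₂)
open import Data.Sum using (_⊎_; inj₁; inj₂)
open import Function using (_∘_; _⇔_; mk⇔; Equivalence)
open import Relation.Nullary using (yes; no; does; ¬_)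
open import Relation.Nullary.Decidable using (¬?)
open import Relation.Nullary.Negation using (contradiction)
open import Relation.Unary using (Pred; Decidable)
open import Relation.Binary.PropositionalEquality
  using (_≡_; _≢_; refl; sym; trans; cong; cong₂; subst; module ≡-Reasoning)

private variable
  a b ℓ ℓ′ : Level
  A B : Set a

concatMap⁺ : (f : A → List B) {xs ys : List A} → xs ↭ ys → concatMap f xs ↭ concatMap f ys
concatMap⁺ f ↭.refl = ↭-refl
concatMap⁺ f (↭.prep x xs↭ys) = ++⁺ˡ (f x) (concatMap⁺ f xs↭ys)
concatMap⁺ f (↭.swap x y xs↭ys) =
  ↭-trans (shifts (f x) (f y)) (++⁺ˡ (f y) (++⁺ˡ (f x) (concatMap⁺ f xs↭ys)))
concatMap⁺ f (↭.trans xs↭ys ys↭zs) = ↭-trans (concatMap⁺ f xs↭ys) (concatMap⁺ f ys↭zs)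

concatMap-cong-↭ : {f g : A → List B} {xs : List A} → All (λ x → f x ↭ g x) xs →
                   concatMap f xs ↭ concatMap g xs
concatMap-cong-↭ [] = ↭-refl
concatMap-cong-↭ (fx↭gx ∷ rest) = ++⁺ fx↭gx (concatMap-cong-↭ rest)

applyUpTo-cong : {f g : ℕ → A} (n : ℕ) → (∀ {i} → i < n → f i ≡ g i) → applyUpTo f n ≡ applyUpTo g n
applyUpTo-cong zero f≡g = refl
applyUpTo-cong (suc n) f≡g = cong₂ _∷_ (f≡g (s≤s z≤n)) (applyUpTo-cong n (f≡g ∘ s≤s))

≤pred⇒suc≤ : ∀ {m n} → 1 ≤ m → m ≤ pred n → suc m ≤ n
≤pred⇒suc≤ {n = zero} (s≤s _) ()
≤pred⇒suc≤ {n = suc n} _ m≤n = s≤s m≤n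

length-filter-map : {P : Pred A ℓ} {Q : Pred B ℓ′} (P? : Decidable P) (Q? : Decidable Q) (f : A → B)
                    {xs : List A} →
                    All (λ x → does (P? x) ≡ does (Q? (f x))) xs →
                    length (filter P? xs) ≡ length (filter Q? (map f xs))
length-filter-map P? Q? f [] = refl
length-filter-map P? Q? f {x ∷ xs} (same ∷ rest) with does (P? x) | does (Q? (f x))
... | true  | true  = cong suc (length-filter-map P? Q? f rest)
... | false | false = length-filter-map P? Q? f rest
length-filter-map P? Q? f (() ∷ _) | true  | false
length-filter-map P? Q? f (() ∷ _) | false | true

∈-subseqs⁺ : ∀ {s π} → s ⊆ π → s ∈ subseqs π
∈-subseqs⁺ [] = here refl
∈-subseqs⁺ (_∷ʳ_ {ys = π} w s⊆π) = ∈-++⁺ʳ (map (w ∷_) (subseqs π)) (∈-subseqs⁺ s⊆π)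
∈-subseqs⁺ (_∷_ {x = w} refl s⊆π) = ∈-++⁺ˡ (∈-map⁺ (w ∷_) (∈-subseqs⁺ s⊆π))

∈-subseqs⁻ : ∀ {s} π → s ∈ subseqs π → s ⊆ π
∈-subseqs⁻ [] (here refl) = []
∈-subseqs⁻ (w ∷ π) s∈ with ∈-++⁻ (map (w ∷_) (subseqs π)) s∈
... | inj₂ s∈′ = w ∷ʳ ∈-subseqs⁻ π s∈′
... | inj₁ s∈′ with ∈-map⁻ (w ∷_) s∈′
...   | _ , s′∈ , refl = refl ∷ ∈-subseqs⁻ π s′∈

containsᵇ⇔ : ∀ σ π → containsᵇ σ π ≡ true ⇔ ∃ λ s → s ⊆ π × orderIso s σ ≡ true
containsᵇ⇔ σ π = mk⇔
  (λ contains → let s , s∈ , iso = find (any⁻ _ (subseqs π) (Equivalence.from T-≡ contains))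
                in s , ∈-subseqs⁻ π s∈ , Equivalence.to T-≡ iso)
  (λ (s , s⊆π , iso) → Equivalence.to T-≡ (any⁺ _ (lose (∈-subseqs⁺ s⊆π) (Equivalence.from T-≡ iso))))

count : ℕ → List ℕ → ℕ
count x [] = 0
count x (w ∷ π) with w ≟ℕ x
... | yes _ = suc (count x π)
... | no _ = count x π

countAfter : ℕ → ℕ → List ℕ → ℕ
countAfter y x [] = 0
countAfter y x (w ∷ π) with w ≟ℕ y
... | yes _ = count x π
... | no _ = countAfter y x π

replicate-⊆⇒≤count : ∀ k {x π} → replicate k x ⊆ π → k ≤ count x π
replicate-⊆⇒≤count zero _ = z≤n
replicate-⊆⇒≤count (suc k) {x} (w ∷ʳ rep⊆π) with w ≟ℕ x
... | yes _ = ≤-trans (replicate-⊆⇒≤count (suc k) rep⊆π) (n≤1+n _)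
... | no _ = replicate-⊆⇒≤count (suc k) rep⊆π
replicate-⊆⇒≤count (suc k) {x} (refl ∷ rep⊆π) with x ≟ℕ x
... | yes _ = s≤s (replicate-⊆⇒≤count k rep⊆π)
... | no x≢x = contradiction refl x≢x

≤count⇒replicate-⊆ : ∀ k {x} π → k ≤ count x π → replicate k x ⊆ π
≤count⇒replicate-⊆ zero π _ = []⊆-universal π
≤count⇒replicate-⊆ (suc k) {x} (w ∷ π) k<count with w ≟ℕ x
... | yes refl = refl ∷ ≤count⇒replicate-⊆ k π (s≤s⁻¹ k<count)
... | no _ = w ∷ʳ ≤count⇒replicate-⊆ (suc k) π k<count

<ᵇ≡true : ∀ {m n} → m < n → (m <ᵇ n) ≡ true
<ᵇ≡true m<n = Equivalence.to T-≡ (<⇒<ᵇ m<n)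

<ᵇ≡false : ∀ {m n} → n ≤ m → (m <ᵇ n) ≡ false
<ᵇ≡false {m} {n} n≤m with m <ᵇ n in m<ᵇn
... | false = refl
... | true = contradiction n≤m (<⇒≱ (<ᵇ⇒< m n (Equivalence.from T-≡ m<ᵇn)))

<ᵇ≡true⇒< : ∀ m n → (m <ᵇ n) ≡ true → m < n
<ᵇ≡true⇒< m n m<ᵇn = <ᵇ⇒< m n (Equivalence.from T-≡ m<ᵇn)

<ᵇ≡false⇒≥ : ∀ m n → (m <ᵇ n) ≡ false → n ≤ m
<ᵇ≡false⇒≥ m n m≮ᵇn = ≮⇒≥ λ m<n → contradiction (trans (sym (<ᵇ≡true m<n)) m≮ᵇn) λ ()

record SameOrder (a x b y : ℕ) : Set where
  constructor same-order
  field
    above : (a <ᵇ x) ≡ (b <ᵇ y)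
    below : (x <ᵇ a) ≡ (y <ᵇ b)

same-order-refl : ∀ x y → SameOrder x x y y
same-order-refl x y = same-order (trans x≮x (sym y≮y)) (trans x≮x (sym y≮y))
  where
  x≮x = <ᵇ≡false {x} ≤-refl
  y≮y = <ᵇ≡false {y} ≤-refl

<-same-order : ∀ {x y a b} → x < y → a < b → SameOrder x y a b
<-same-order x<y a<b = same-order (trans (<ᵇ≡true x<y) (sym (<ᵇ≡true a<b)))
                                  (trans (<ᵇ≡false (<⇒≤ x<y)) (sym (<ᵇ≡false (<⇒≤ a<b))))

>-same-order : ∀ {x y a b} → x < y → a < b → SameOrder y x b a
>-same-order x<y a<b = same-order (trans (<ᵇ≡false (<⇒≤ x<y)) (sym (<ᵇ≡false (<⇒≤ a<b))))
                                  (trans (<ᵇ≡true x<y) (sym (<ᵇ≡true a<b)))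

sameRel-∷⁻ : ∀ a b x y xs ys → sameRel a b (x ∷ xs) (y ∷ ys) ≡ true →
             SameOrder a x b y × sameRel a b xs ys ≡ true
sameRel-∷⁻ a b x y xs ys h with a <ᵇ x in e₁ | b <ᵇ y in e₂ | x <ᵇ a in e₃ | y <ᵇ b in e₄
... | true  | true  | true  | true  = same-order (trans e₁ (sym e₂)) (trans e₃ (sym e₄)) , h
... | true  | true  | false | false = same-order (trans e₁ (sym e₂)) (trans e₃ (sym e₄)) , h
... | false | false | true  | true  = same-order (trans e₁ (sym e₂)) (trans e₃ (sym e₄)) , h
... | false | false | false | false = same-order (trans e₁ (sym e₂)) (trans e₃ (sym e₄)) , h
sameRel-∷⁻ a b x y xs ys () | true  | false | _     | _
sameRel-∷⁻ a b x y xs ys () | false | true  | _     | _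
sameRel-∷⁻ a b x y xs ys () | true  | true  | true  | false
sameRel-∷⁻ a b x y xs ys () | true  | true  | false | true
sameRel-∷⁻ a b x y xs ys () | false | false | true  | false
sameRel-∷⁻ a b x y xs ys () | false | false | false | true

sameRel-∷⁺ : ∀ {a b x y xs ys} → SameOrder a x b y → sameRel a b xs ys ≡ true →
             sameRel a b (x ∷ xs) (y ∷ ys) ≡ true
sameRel-∷⁺ {b = b} {y = y} (same-order above below) h rewrite above | below with b <ᵇ y | y <ᵇ b
... | true  | true  = h
... | true  | false = h
... | false | true  = h
... | false | false = h

sameRel-replicate⁺ : ∀ {a b x y} → SameOrder a x b y →
                     ∀ k → sameRel a b (replicate k x) (replicate k y) ≡ true
sameRel-replicate⁺ same zero = refl
sameRel-replicate⁺ {x = x} {y} same (suc k) =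
  sameRel-∷⁺ {xs = replicate k x} {ys = replicate k y} same (sameRel-replicate⁺ same k)

sameRel-replicate⁻ : ∀ {a b} k zs → sameRel a b zs (replicate k b) ≡ true → zs ≡ replicate k a
sameRel-replicate⁻ zero [] h = refl
sameRel-replicate⁻ {a} {b} (suc k) (z ∷ zs) h with sameRel-∷⁻ a b z b zs (replicate k b) h
... | same-order a≮z z≮a , h′ = cong₂ _∷_
  (≤-antisym (<ᵇ≡false⇒≥ a z (trans a≮z b≮b)) (<ᵇ≡false⇒≥ z a (trans z≮a b≮b)))
  (sameRel-replicate⁻ k zs h′)
  where b≮b = <ᵇ≡false {b} ≤-refl

orderIso-replicate : ∀ k x y → orderIso (replicate k x) (replicate k y) ≡ true
orderIso-replicate zero x y = refl
orderIso-replicate (suc k) x y rewrite sameRel-replicate⁺ (same-order-refl x y) k = orderIso-replicate k x y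

1<2 : 1 < 2
1<2 = s≤s (s≤s z≤n)

orderIso-1∷2s⁺ : ∀ {x y} → x < y → ∀ k → orderIso (x ∷ replicate k y) (1 ∷ replicate k 2) ≡ true
orderIso-1∷2s⁺ {y = y} x<y k rewrite sameRel-replicate⁺ (<-same-order x<y 1<2) k = orderIso-replicate k y 2

orderIso-1∷2s⁻ : ∀ c s → orderIso s (1 ∷ replicate (suc c) 2) ≡ true →
                 ∃₂ λ x y → x < y × s ≡ x ∷ replicate (suc c) y
orderIso-1∷2s⁻ c (x ∷ y ∷ zs) iso =
  let iso-head = ∧-conicalˡ (sameRel x 1 (y ∷ zs) (2 ∷ replicate c 2)) _ iso
      iso-tail = ∧-conicalʳ (sameRel x 1 (y ∷ zs) (2 ∷ replicate c 2)) _ iso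
      same-order x<ᵇy _ , _ = sameRel-∷⁻ x 1 y 2 zs _ iso-head
      zs≡ = sameRel-replicate⁻ c zs (∧-conicalˡ (sameRel y 2 zs (replicate c 2)) _ iso-tail)
  in x , y , <ᵇ≡true⇒< x y x<ᵇy , cong (λ t → x ∷ y ∷ t) zs≡

orderIso-1∷2∷1s⁺ : ∀ {x y} → x < y → ∀ k → orderIso (x ∷ y ∷ replicate k x) (1 ∷ 2 ∷ replicate k 1) ≡ true
orderIso-1∷2∷1s⁺ {x} {y} x<y k
  rewrite sameRel-∷⁺ {xs = replicate k x} {ys = replicate k 1}
            (<-same-order x<y 1<2) (sameRel-replicate⁺ (same-order-refl x 1) k)
        | sameRel-replicate⁺ (>-same-order x<y 1<2) k
  = orderIso-replicate k x 1

orderIso-1∷2∷1s⁻ : ∀ k s → orderIso s (1 ∷ 2 ∷ replicate k 1) ≡ true →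
                   ∃₂ λ x y → x < y × s ≡ x ∷ y ∷ replicate k x
orderIso-1∷2∷1s⁻ k (x ∷ y ∷ zs) iso =
  let iso-head = ∧-conicalˡ (sameRel x 1 (y ∷ zs) (2 ∷ replicate k 1)) _ iso
      same-order x<ᵇy _ , zs-iso = sameRel-∷⁻ x 1 y 2 zs _ iso-head
  in x , y , <ᵇ≡true⇒< x y x<ᵇy , cong (λ t → x ∷ y ∷ t) (sameRel-replicate⁻ k zs zs-iso)

data Letter (M : ℕ) : ℕ → Set where
  old : ∀ {v} → 1 ≤ v → v ≤ M → Letter M v
  new : Letter M (suc M)

-- π can follow a prefix of a canonical sequence whose maximum is M (cf. extend M).
data Canonical : ℕ → List ℕ → Set where
  [] : ∀ {M} → Canonical M []
  _∷_ : ∀ {M v π} → Letter M v → Canonical (M ⊔ v) π → Canonical M (v ∷ π)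

letters : ℕ → List ℕ
letters M = map suc (upTo (suc M))

letters-Letter : ∀ M → All (Letter M) (letters M)
letters-Letter M = All.map⁺ (All.applyUpTo⁺₁ _ (suc M) letter)
  where
  letter : ∀ {i} → i < suc M → Letter M (suc i)
  letter i<1+M with m<1+n⇒m<n∨m≡n i<1+M
  ... | inj₁ i<M = old (s≤s z≤n) i<M
  ... | inj₂ refl = new

extend-canonical : ∀ M k → All (Canonical M) (extend M k)
extend-canonical M zero = [] ∷ []
extend-canonical M (suc k) =
  All.concat⁺ (All.map⁺ (All.map (λ v → All.map⁺ (All.map (v ∷_) (extend-canonical _ k)))
                                 (letters-Letter M)))

letter-positive : ∀ {M v} → Letter M v → 1 ≤ v
letter-positive (old 1≤v _) = 1≤v
letter-positive new = s≤s z≤n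

canonical-positive : ∀ {M π} → Canonical M π → All (1 ≤_) π
canonical-positive [] = []
canonical-positive (l ∷ can) = letter-positive l ∷ canonical-positive can

letter>⇒new : ∀ {M w x} → Letter M w → M ≤ x → x < w → M ≡ x × w ≡ suc x
letter>⇒new (old _ w≤M) M≤x x<w = contradiction (≤-trans w≤M M≤x) (<⇒≱ x<w)
letter>⇒new new M≤x (s≤s x≤M) = let M≡x = ≤-antisym M≤x x≤M in M≡x , cong suc M≡x

letter-⊔-≤ : ∀ {M w x} → Letter M w → M ≤ x → w ≢ suc x → M ⊔ w ≤ x
letter-⊔-≤ (old _ w≤M) M≤x _ = ⊔-lub M≤x (≤-trans w≤M M≤x)
letter-⊔-≤ new M≤x w≢ = ⊔-lub M≤x (≤∧≢⇒< M≤x (λ M≡x → w≢ (cong suc M≡x)))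

⊔≡⇒≡ : ∀ {M w x} → M ⊔ w ≡ x → w ≢ x → M ≡ x
⊔≡⇒≡ {M} {w} M⊔w≡x w≢x with ⊔-sel M w
... | inj₁ M⊔w≡M = trans (sym M⊔w≡M) M⊔w≡x
... | inj₂ M⊔w≡w = contradiction (trans (sym M⊔w≡w) M⊔w≡x) w≢x

⊆⇒≤countAfter : ∀ {M π x y} c → Canonical M π → M ≤ x → x < y →
                y ∷ replicate c x ⊆ π → c ≤ countAfter (suc x) x π
⊆⇒≤countAfter {x = x} c (_∷_ {v = w} l can) M≤x x<y (_ ∷ʳ pat⊆π) with w ≟ℕ suc x
... | yes _ = replicate-⊆⇒≤count c (∷ˡ⁻ pat⊆π)
... | no w≢ = ⊆⇒≤countAfter c can (letter-⊔-≤ l M≤x w≢) x<y pat⊆π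
⊆⇒≤countAfter {x = x} {y} c (l ∷ can) M≤x x<y (refl ∷ rep⊆π) with y ≟ℕ suc x
... | yes _ = replicate-⊆⇒≤count c rep⊆π
... | no y≢ = contradiction (proj₂ (letter>⇒new l M≤x x<y)) y≢

-- In the second alternative x is the maximum of the prefix, so the missing x occurs there.
≤countAfter⇒⊆ : ∀ {M π x} c → 1 ≤ c → Canonical M π → M ≤ x → c ≤ countAfter (suc x) x π →
                x ∷ suc x ∷ replicate c x ⊆ π ⊎ (M ≡ x × suc x ∷ replicate c x ⊆ π)
≤countAfter⇒⊆ (suc c) _ [] _ ()
≤countAfter⇒⊆ {x = x} c 1≤c (_∷_ {v = w} {π} l can) M≤x c≤ with w ≟ℕ suc x
... | yes refl = inj₂ (proj₁ (letter>⇒new l M≤x (n<1+n x)) , refl ∷ ≤count⇒replicate-⊆ c π c≤)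
... | no w≢ with ≤countAfter⇒⊆ c 1≤c can (letter-⊔-≤ l M≤x w≢) c≤
...   | inj₁ pat⊆π = inj₁ (w ∷ʳ pat⊆π)
...   | inj₂ (M⊔w≡x , pat⊆π) with w ≟ℕ x
...     | yes refl = inj₁ (refl ∷ pat⊆π)
...     | no w≢x = inj₂ (⊔≡⇒≡ M⊔w≡x w≢x , w ∷ʳ pat⊆π)

contains-1∷2s⁻ : ∀ c {π} → Canonical 0 π → containsᵇ (1 ∷ replicate (suc c) 2) π ≡ true →
                 ∃ λ y → suc c ≤ count (suc (suc y)) π
contains-1∷2s⁻ c {π} can contains with Equivalence.to (containsᵇ⇔ _ π) contains
... | s , s⊆π , iso with orderIso-1∷2s⁻ c s iso
...   | x , y , x<y , refl with All-resp-⊆ s⊆π (canonical-positive can)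
...     | 1≤x ∷ _ = witness 1≤x x<y (∷ˡ⁻ s⊆π)
  where
  witness : ∀ {x y} → 1 ≤ x → x < y → replicate (suc c) y ⊆ π → ∃ λ y′ → suc c ≤ count (suc (suc y′)) π
  witness (s≤s z≤n) (s≤s (s≤s _)) rep⊆π = _ , replicate-⊆⇒≤count (suc c) rep⊆π

contains-1∷2s⁺ : ∀ c {π} → Canonical 0 π → ∃ (λ y → suc c ≤ count (suc (suc y)) π) →
                 containsᵇ (1 ∷ replicate (suc c) 2) π ≡ true
contains-1∷2s⁺ c [] (_ , ())
contains-1∷2s⁺ c (old (s≤s _) () ∷ _) _
contains-1∷2s⁺ c {1 ∷ π} (new ∷ _) (y , c<count) = Equivalence.from (containsᵇ⇔ _ (1 ∷ π))
  (_ , refl ∷ ≤count⇒replicate-⊆ (suc c) π c<count , orderIso-1∷2s⁺ (s≤s (s≤s z≤n)) (suc c))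

contains-1∷2∷1s⁻ : ∀ c {π} → Canonical 0 π → containsᵇ (1 ∷ 2 ∷ replicate c 1) π ≡ true →
                   ∃ λ y → c ≤ countAfter (suc (suc y)) (suc y) π
contains-1∷2∷1s⁻ c {π} can contains with Equivalence.to (containsᵇ⇔ _ π) contains
... | s , s⊆π , iso with orderIso-1∷2∷1s⁻ c s iso
...   | x , z , x<z , refl with All-resp-⊆ s⊆π (canonical-positive can)
...     | s≤s z≤n ∷ _ = _ , ⊆⇒≤countAfter c can z≤n x<z (∷ˡ⁻ s⊆π)

contains-1∷2∷1s⁺ : ∀ c {π} → 1 ≤ c → Canonical 0 π → ∃ (λ y → c ≤ countAfter (suc (suc y)) (suc y) π) →
                   containsᵇ (1 ∷ 2 ∷ replicate c 1) π ≡ true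
contains-1∷2∷1s⁺ c {π} 1≤c can (y , c≤) with ≤countAfter⇒⊆ c 1≤c can z≤n c≤
... | inj₁ pat⊆π = Equivalence.from (containsᵇ⇔ _ π) (_ , pat⊆π , orderIso-1∷2∷1s⁺ (n<1+n (suc y)) c)
... | inj₂ (() , _)

rotate : ℕ → ℕ → ℕ
rotate zero v = v
rotate (suc L) zero = zero
rotate (suc L) (suc zero) = suc L
rotate (suc L) (suc (suc w)) with w <? L
... | yes _ = suc w
... | no _ = suc (suc w)

relabel : ℕ → List ℕ → List ℕ
relabel M [] = []
relabel M (v ∷ π) = rotate M v ∷ relabel (M ⊔ v) π

rotate-new : ∀ M → rotate M (suc M) ≡ suc M
rotate-new zero = refl
rotate-new (suc L) with L <? L
... | yes L<L = contradiction L<L (<-irrefl refl)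
... | no _ = refl

rotate-shift : ∀ {M w} → suc (suc w) ≤ M → rotate M (suc (suc w)) ≡ suc w
rotate-shift {suc L} {w} (s≤s w<L) with w <? L
... | yes _ = refl
... | no w≮L = contradiction w<L w≮L

rotate-old : ∀ {M w} → 1 ≤ w → w ≤ M → 1 ≤ rotate M w × rotate M w ≤ M
rotate-old {suc L} {suc zero} _ _ = s≤s z≤n , ≤-refl
rotate-old {suc L} {suc (suc w)} _ w≤M rewrite rotate-shift w≤M = s≤s z≤n , ≤-trans (n≤1+n _) w≤M

rotate-shift⁻¹ : ∀ {M w y} → Letter M w → suc (suc y) ≤ M → rotate M w ≡ suc y → w ≡ suc (suc y)
rotate-shift⁻¹ {suc L} (old {suc zero} _ _) (s≤s L<L) refl = contradiction L<L (<-irrefl refl)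
rotate-shift⁻¹ (old {suc (suc w)} _ w≤M) _ hit rewrite rotate-shift w≤M = cong suc hit
rotate-shift⁻¹ {M} new y<M hit with trans (sym (rotate-new M)) hit
... | refl = contradiction (≤-trans (n≤1+n _) y<M) (<-irrefl refl)

rotate-new⁻¹ : ∀ {M w x} → Letter M w → M ≤ x → rotate M w ≡ suc x → w ≡ suc x
rotate-new⁻¹ (old 1≤w w≤M) M≤x hit =
  contradiction (≤-trans (proj₂ (rotate-old 1≤w w≤M)) M≤x) (<⇒≱ (subst (_ <_) (sym hit) (n<1+n _)))
rotate-new⁻¹ {M} new _ hit = trans (sym (rotate-new M)) hit

rotate-Letter : ∀ {M v} → Letter M v → Letter M (rotate M v)
rotate-Letter (old 1≤v v≤M) = let 1≤r , r≤M = rotate-old 1≤v v≤M in old 1≤r r≤M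
rotate-Letter {M} new rewrite rotate-new M = new

rotate-⊔ : ∀ {M v} → Letter M v → M ⊔ rotate M v ≡ M ⊔ v
rotate-⊔ (old 1≤v v≤M) = trans (m≥n⇒m⊔n≡m (proj₂ (rotate-old 1≤v v≤M))) (sym (m≥n⇒m⊔n≡m v≤M))
rotate-⊔ {M} new = cong (M ⊔_) (rotate-new M)

letters-suc : ∀ L → letters (suc L) ≡ applyUpTo suc L ++ suc L ∷ [ suc (suc L) ]
letters-suc L = begin
  map suc (upTo (suc (suc L)))                      ≡⟨ map-upTo suc (suc (suc L)) ⟩
  applyUpTo suc (suc (suc L))                       ≡⟨ applyUpTo-∷ʳ suc (suc L) ⟨
  applyUpTo suc (suc L) ++ [ suc (suc L) ]          ≡⟨ cong (_++ [ suc (suc L) ]) (applyUpTo-∷ʳ suc L) ⟨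
  (applyUpTo suc L ++ [ suc L ]) ++ [ suc (suc L) ] ≡⟨ ++-assoc (applyUpTo suc L) _ _ ⟩
  applyUpTo suc L ++ suc L ∷ [ suc (suc L) ]        ∎
  where open ≡-Reasoning

rotate-letters-suc : ∀ L → map (rotate (suc L)) (letters (suc L)) ≡
                           suc L ∷ applyUpTo suc L ++ [ suc (suc L) ]
rotate-letters-suc L = cong (suc L ∷_) (begin
    map (rotate (suc L)) (map suc (applyUpTo suc (suc L)))
  ≡⟨ cong (map (rotate (suc L))) (map-applyUpTo suc suc (suc L)) ⟩
    map (rotate (suc L)) (applyUpTo (suc ∘ suc) (suc L))
  ≡⟨ map-applyUpTo (suc ∘ suc) (rotate (suc L)) (suc L) ⟩
    applyUpTo (rotate (suc L) ∘ suc ∘ suc) (suc L)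
  ≡⟨ applyUpTo-∷ʳ _ L ⟨
    applyUpTo (rotate (suc L) ∘ suc ∘ suc) L ++ [ rotate (suc L) (suc (suc L)) ]
  ≡⟨ cong₂ (λ xs x → xs ++ [ x ]) (applyUpTo-cong L (rotate-shift ∘ s≤s)) (rotate-new (suc L)) ⟩
    applyUpTo suc L ++ [ suc (suc L) ]
  ∎)
  where open ≡-Reasoning

rotate-letters : ∀ M → map (rotate M) (letters M) ↭ letters M
rotate-letters zero = ↭-refl
rotate-letters (suc L) = begin
  map (rotate (suc L)) (letters (suc L))      ≡⟨ rotate-letters-suc L ⟩
  suc L ∷ applyUpTo suc L ++ [ suc (suc L) ]  ↭⟨ shift (suc L) (applyUpTo suc L) _ ⟨
  applyUpTo suc L ++ suc L ∷ [ suc (suc L) ]  ≡⟨ letters-suc L ⟨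
  letters (suc L)                             ∎
  where open PermutationReasoning

relabel-canonical : ∀ {M π} → Canonical M π → Canonical M (relabel M π)
relabel-canonical [] = []
relabel-canonical {M} (_∷_ {v = v} {π} l can) =
  rotate-Letter l ∷ subst (λ N → Canonical N (relabel (M ⊔ v) π)) (sym (rotate-⊔ l))
                          (relabel-canonical can)

relabel-extend : ∀ M k → map (relabel M) (extend M k) ↭ extend M k
relabel-extend M zero = ↭-refl
relabel-extend M (suc k) = begin
    map (relabel M) (concatMap block (letters M))
  ≡⟨ map-concatMap (relabel M) block (letters M) ⟩
    concatMap (map (relabel M) ∘ block) (letters M)
  ↭⟨ concatMap-cong-↭ (All.map relabel-block (letters-Letter M)) ⟩
    concatMap (block ∘ rotate M) (letters M)
  ≡⟨ concatMap-map block (rotate M) (letters M) ⟨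
    concatMap block (map (rotate M) (letters M))
  ↭⟨ concatMap⁺ block (rotate-letters M) ⟩
    concatMap block (letters M)
  ∎
  where
  open PermutationReasoning
  block : ℕ → List (List ℕ)
  block v = map (v ∷_) (extend (M ⊔ v) k)
  relabel-block : ∀ {v} → Letter M v → map (relabel M) (block v) ↭ block (rotate M v)
  relabel-block {v} l = begin
      map (relabel M) (map (v ∷_) (extend (M ⊔ v) k))
    ≡⟨ map-∘ (extend (M ⊔ v) k) ⟨
      map (λ π → rotate M v ∷ relabel (M ⊔ v) π) (extend (M ⊔ v) k)
    ≡⟨ map-∘ (extend (M ⊔ v) k) ⟩
      map (rotate M v ∷_) (map (relabel (M ⊔ v)) (extend (M ⊔ v) k))
    ↭⟨ ↭.map⁺ (rotate M v ∷_) (relabel-extend (M ⊔ v) k) ⟩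
      map (rotate M v ∷_) (extend (M ⊔ v) k)
    ≡⟨ cong (λ N → map (rotate M v ∷_) (extend N k)) (rotate-⊔ l) ⟨
      block (rotate M v)
    ∎

count-relabel-old : ∀ {M π y} → Canonical M π → suc (suc y) ≤ M →
                    count (suc y) (relabel M π) ≡ count (suc (suc y)) π
count-relabel-old [] _ = refl
count-relabel-old {M} {y = y} (_∷_ {v = w} l can) y<M
  with rotate M w ≟ℕ suc y | w ≟ℕ suc (suc y) | count-relabel-old can (≤-trans y<M (m≤m⊔n M w))
... | yes _   | yes _    | ih = cong suc ih
... | no _    | no _     | ih = ih
... | yes hit | no w≢    | _  = contradiction (rotate-shift⁻¹ l y<M hit) w≢
... | no miss | yes refl | _  = contradiction (rotate-shift y<M) miss

countAfter-relabel : ∀ {M π y} → Canonical M π → M ≤ suc y →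
                     countAfter (suc (suc y)) (suc y) (relabel M π) ≡ pred (count (suc (suc y)) π)
countAfter-relabel [] _ = refl
countAfter-relabel {M} {y = y} (_∷_ {v = w} l can) M≤1+y
  with rotate M w ≟ℕ suc (suc y) | w ≟ℕ suc (suc y)
... | yes _   | yes refl = count-relabel-old can (m≤n⊔m M (suc (suc y)))
... | no _    | no w≢    = countAfter-relabel can (letter-⊔-≤ l M≤1+y w≢)
... | yes hit | no w≢    = contradiction (rotate-new⁻¹ l M≤1+y hit) w≢
... | no miss | yes refl =
  let M≡1+y , _ = letter>⇒new l M≤1+y (n<1+n _)
  in contradiction (subst (λ N → rotate M (suc N) ≡ suc N) M≡1+y (rotate-new M)) miss

contains-relabel : ∀ c {π} → 1 ≤ c → Canonical 0 π →
  containsᵇ (1 ∷ replicate (suc c) 2) π ≡ containsᵇ (1 ∷ 2 ∷ replicate c 1) (relabel 0 π)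
contains-relabel c {π} 1≤c can = ⇔→≡ (mk⇔
  (contains-1∷2∷1s⁺ c 1≤c (relabel-canonical can) ∘ map₂ count→countAfter ∘ contains-1∷2s⁻ c can)
  (contains-1∷2s⁺ c can ∘ map₂ countAfter→count ∘ contains-1∷2∷1s⁻ c (relabel-canonical can)))
  where
  count→countAfter : ∀ {y} → suc c ≤ count (suc (suc y)) π →
                     c ≤ countAfter (suc (suc y)) (suc y) (relabel 0 π)
  count→countAfter c<count = subst (c ≤_) (sym (countAfter-relabel can z≤n)) (suc[m]≤n⇒m≤pred[n] c<count)
  countAfter→count : ∀ {y} → c ≤ countAfter (suc (suc y)) (suc y) (relabel 0 π) →
                     suc c ≤ count (suc (suc y)) π
  countAfter→count c≤ = ≤pred⇒suc≤ 1≤c (subst (c ≤_) (countAfter-relabel can z≤n) c≤)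

mainTheorem6 : (m : ℕ) → 1 ≤ m →
    Equivalent (1 ∷ replicate m 2) (1 ∷ 2 ∷ replicate (m ∸ 1) 1)
mainTheorem6 (suc zero) _ n = refl
mainTheorem6 (suc (suc c)) _ n = begin
    length (filter (avoids σ) (partitions n))
  ≡⟨ length-filter-map _ _ (relabel 0) same-verdict ⟩
    length (filter (avoids τ) (map (relabel 0) (partitions n)))
  ≡⟨ ↭-length (filter-↭ (avoids τ) (relabel-extend 0 n)) ⟩
    length (filter (avoids τ) (partitions n))
  ∎
  where
  open ≡-Reasoning
  σ τ : List ℕ
  σ = 1 ∷ replicate (suc (suc c)) 2
  τ = 1 ∷ 2 ∷ replicate (suc c) 1
  avoids : (σ′ : List ℕ) → Decidable (λ π → ¬ Contains σ′ π)
  avoids σ′ π = ¬? (containsᵇ σ′ π ≟ true)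
  same-verdict : All (λ π → does (avoids σ π) ≡ does (avoids τ (relabel 0 π))) (partitions n)
  same-verdict = All.map (cong (λ b → does (¬? (b ≟ true))) ∘ contains-relabel (suc c) (s≤s z≤n))
                         (extend-canonical 0 n)
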